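{- For positive integers $k \le n$, as polynomials in $x_1,\ldots,x_n$, $$\frac{1}{n!} \sum_{\sigma \in S_n} \prod_{j = k}^n \bigl(jx_{\sigma(j)} + x_{\sigma(j+1)} + \cdots + x_{\sigma(n)}\bigr) = (x_1+x_2+\cdots+x_n)^{n-k+1},$$ where $S_n$ is the symmetric group on $\{1,\ldots,n\}$. -}

module Defs where

open import Level using (Level)
open import Data.Nat as ℕ using (ℕ; zero; suc; _<?_; _≤?_)
open import Data.Fin using (Fin; toℕ) renaming (zero to fzero; suc to fsuc)
open import Data.Fin.Properties using (all?)
open import Data.List using (List; []; _∷_; [_]; map; concatMap; filter; foldr)
open import Data.Fin.Base using () renaming (_<_ to _<ᶠ_)
open import Relation.Binary.PropositionalEquality using (_≡_)
open import Relation.Nullary using (Dec; yes; no; does)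
open import Relation.Nullary.Decidable using (_→-dec_)
open import Algebra.Bundles using (CommutativeRing)

allFin : (m : ℕ) → List (Fin m)
allFin zero = []
allFin (suc m) = fzero ∷ map fsuc (allFin m)

cons : ∀ {n m} → Fin m → (Fin n → Fin m) → (Fin (suc n) → Fin m)
cons a f fzero = a
cons a f (fsuc i) = f i

allFuns : (n m : ℕ) → List (Fin n → Fin m)
allFuns zero m = [ (λ ()) ]
allFuns (suc n) m = concatMap (λ f → map (λ a → cons a f) (allFin m)) (allFuns n m)

Injective : ∀ {n} → (Fin n → Fin n) → Set
Injective {n} σ = ∀ (i j : Fin n) → σ i ≡ σ j → i ≡ j

injective? : ∀ {n} (σ : Fin n → Fin n) → Dec (Injective σ)
injective? σ = all? λ i → all? λ j → (σ i Data.Fin.≟ σ j) →-dec (i Data.Fin.≟ j)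

-- The symmetric group S_n on Fin n = {0,…,n-1}, listed: all injective
-- (equivalently bijective) self-maps of Fin n, each exactly once.
Sym : (n : ℕ) → List (Fin n → Fin n)
Sym n = filter injective? (allFuns n n)

module RingOps {c ℓ} (R : CommutativeRing c ℓ) where
  open CommutativeRing R

  _·_ : ℕ → Carrier → Carrier
  zero · r = 0#
  suc m · r = r + (m · r)

  _^_ : Carrier → ℕ → Carrier
  r ^ zero = 1#
  r ^ suc m = r * (r ^ m)

  sumList : ∀ {a} {A : Set a} → (A → Carrier) → List A → Carrier
  sumList f = foldr (λ a acc → f a + acc) 0#

  sumFin : ∀ n → (Fin n → Carrier) → Carrier
  sumFin zero f = 0#
  sumFin (suc n) f = f fzero + sumFin n (λ i → f (fsuc i))

  prodFin : ∀ n → (Fin n → Carrier) → Carrier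
  prodFin zero f = 1#
  prodFin (suc n) f = f fzero * prodFin n (λ i → f (fsuc i))

  -- Using 0-based positions i = j-1 (j = 1..n):
  -- factor j  =  j·x_{σ(j)} + x_{σ(j+1)} + … + x_{σ(n)}
  factor : ∀ n → (Fin n → Carrier) → (Fin n → Fin n) → Fin n → Carrier
  factor n x σ i =
    (suc (toℕ i) · x (σ i))
      + sumFin n (λ m → if does (toℕ i <? toℕ m) then x (σ m) else 0#)
    where open import Data.Bool using (if_then_else_)

  term : ∀ n → ℕ → (Fin n → Carrier) → (Fin n → Fin n) → Carrier
  term n k x σ =
    prodFin n (λ i → if does (k ≤? suc (toℕ i)) then factor n x σ i else 1#)
    where open import Data.Bool using (if_then_else_)

  LHS : ∀ n → ℕ → (Fin n → Carrier) → Carrier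
  LHS n k x = sumList (term n k x) (Sym n)

-- Write T_h σ for the product of the factors at 0-based positions ≥ h, so the left-hand side is
-- Σ_{σ ∈ S_n} T_{k-1} σ. As T_{h+1} σ only involves σ(h+1), …, σ(n-1), precomposing σ with a
-- transposition of two positions ≤ h fixes it while permuting S_n; hence Σ_σ x_{σ(m)} T_{h+1} σ
-- is the same for every m ≤ h. The factor at position h is (h+1) x_{σ(h)} + Σ_{m>h} x_{σ(m)}, so
-- after summing over σ it may be replaced by Σ_m x_{σ(m)} = x_1 + ⋯ + x_n, which gives
-- Σ_σ T_h σ = (x_1 + ⋯ + x_n) Σ_σ T_{h+1} σ. Iterating down to T_n = 1 and counting |S_n| = n!
-- as the number of injective self-maps of Fin n proves the identity.
module Submission where

open import Defs
open import Level using (Level)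
open import Algebra.Bundles using (CommutativeSemiring; CommutativeRing)
open import Data.Bool.Base using (true; false; not; _∧_; _∨_; if_then_else_)
open import Data.List.Base using (List; []; _∷_; _++_; foldr; map; concatMap; filter; length)
open import Data.List.Properties using (length-map)
open import Data.List.Membership.Propositional using (_∈_)
open import Data.List.Membership.Propositional.Properties using (∈-filter⁻)
open import Data.List.Relation.Unary.Any using (here; there)
open import Data.Fin.Base using (Fin; toℕ; fromℕ<; punchOut)
  renaming (zero to fzero; suc to fsuc)
open import Data.Fin.Properties
  using (_≟_; any?; all?; suc-injective; toℕ-injective; toℕ-fromℕ<; toℕ<n;
         punchOut-injective; injective⇒≤)
open import Data.Nat as ℕ using (ℕ; zero; suc; _≤_; _<_; z≤n; s≤s; _!)
import Data.Nat.Properties as ℕₚ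
open import Data.Nat.Combinatorics using (_P_; nPn≡n!)
open import Data.Nat.Combinatorics.Base using (_P′_)
open import Data.Bool.Properties using (T-≡)
open import Data.Product.Base using (∃; _×_; _,_; proj₁; proj₂)
open import Function.Base using (_∘_)
open import Relation.Binary.Core using (_Preserves_⟶_)
open import Relation.Binary.Bundles using (Setoid)
open import Function.Bundles using (_⇔_; mk⇔; module Equivalence)
import Relation.Binary.PropositionalEquality as ≡
open ≡ using (_≡_; _≢_; _≗_)
open import Relation.Nullary using (Dec; yes; no; does; ¬_)
open import Relation.Nullary.Decidable using (_→-dec_; _×-dec_; ¬?; dec-true; dec-false; does-⇔)
open import Relation.Nullary.Negation using (contradiction)

IsInjection : ∀ {p m} → (Fin p → Fin m) → Set
IsInjection f = ∀ i j → f i ≡ f j → i ≡ j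

isInjection? : ∀ {p m} (f : Fin p → Fin m) → Dec (IsInjection f)
isInjection? f = all? λ i → all? λ j → (f i ≟ f j) →-dec (i ≟ j)

InImage : ∀ {p m} → (Fin p → Fin m) → Fin m → Set
InImage f a = ∃ λ i → f i ≡ a

inImage? : ∀ {p m} (f : Fin p → Fin m) (a : Fin m) → Dec (InImage f a)
inImage? f a = any? λ i → f i ≟ a

isInjection-uncons : ∀ {p m} (f : Fin (suc p) → Fin m) →
  IsInjection f ⇔ (IsInjection (f ∘ fsuc) × ¬ InImage (f ∘ fsuc) (f fzero))
isInjection-uncons f = mk⇔
  (λ inj → (λ i j e → suc-injective (inj (fsuc i) (fsuc j) e))
         , (λ { (i , e) → 0≢suc (inj fzero (fsuc i) (≡.sym e)) }))
  (λ { (inj , fresh) → from inj fresh })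
  where
  0≢suc : ∀ {i} → fzero ≢ fsuc i
  0≢suc ()
  from : IsInjection (f ∘ fsuc) → ¬ InImage (f ∘ fsuc) (f fzero) → IsInjection f
  from inj fresh fzero    fzero    e = ≡.refl
  from inj fresh fzero    (fsuc j) e = contradiction (j , ≡.sym e) fresh
  from inj fresh (fsuc i) fzero    e = contradiction (i , e) fresh
  from inj fresh (fsuc i) (fsuc j) e = ≡.cong fsuc (inj i j e)

isInjection-resp : ∀ {p m} {f g : Fin p → Fin m} → f ≗ g → IsInjection f → IsInjection g
isInjection-resp f≗g inj i j e = inj i j (≡.trans (f≗g i) (≡.trans e (≡.sym (f≗g j))))

-- An endomap missing a point a would inject Fin (suc n) into Fin n after punching a out.
injective⇒surjective : ∀ {n} (σ : Fin n → Fin n) → IsInjection σ → ∀ a → InImage σ a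
injective⇒surjective {suc n} σ inj a with inImage? σ a
... | yes hit = hit
... | no miss = contradiction (injective⇒≤ punchOut-σ-injective) (ℕₚ.n≮n n)
  where
  a≢σ : ∀ i → a ≢ σ i
  a≢σ i e = miss (i , ≡.sym e)
  punchOut-σ-injective : ∀ {i j} → punchOut (a≢σ i) ≡ punchOut (a≢σ j) → i ≡ j
  punchOut-σ-injective e = inj _ _ (punchOut-injective (a≢σ _) (a≢σ _) e)

cons-cong : ∀ {n m} (a : Fin m) {f g : Fin n → Fin m} → f ≗ g → cons a f ≗ cons a g
cons-cong a f≗g fzero    = ≡.refl
cons-cong a f≗g (fsuc i) = f≗g i

adjacentSwap : ℕ → ∀ {n} → Fin n → Fin n
adjacentSwap zero    {suc (suc n)} fzero            = fsuc fzero
adjacentSwap zero    {suc (suc n)} (fsuc fzero)     = fzero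
adjacentSwap zero    {suc (suc n)} (fsuc (fsuc i))  = fsuc (fsuc i)
adjacentSwap zero    {suc zero}    fzero            = fzero
adjacentSwap (suc p)               fzero            = fzero
adjacentSwap (suc p)               (fsuc i)         = fsuc (adjacentSwap p i)

adjacentSwap-involutive : ∀ p {n} (i : Fin n) → adjacentSwap p (adjacentSwap p i) ≡ i
adjacentSwap-involutive zero    {suc (suc n)} fzero           = ≡.refl
adjacentSwap-involutive zero    {suc (suc n)} (fsuc fzero)    = ≡.refl
adjacentSwap-involutive zero    {suc (suc n)} (fsuc (fsuc i)) = ≡.refl
adjacentSwap-involutive zero    {suc zero}    fzero           = ≡.refl
adjacentSwap-involutive (suc p)               fzero           = ≡.refl
adjacentSwap-involutive (suc p)               (fsuc i)        = ≡.cong fsuc (adjacentSwap-involutive p i)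

adjacentSwap-fixes : ∀ p {n} (i : Fin n) → suc (suc p) ≤ toℕ i → adjacentSwap p i ≡ i
adjacentSwap-fixes zero    {suc (suc n)} (fsuc fzero)    (s≤s ())
adjacentSwap-fixes zero    {suc (suc n)} (fsuc (fsuc i)) _         = ≡.refl
adjacentSwap-fixes (suc p)               (fsuc i)        (s≤s p≤i) = ≡.cong fsuc (adjacentSwap-fixes p i p≤i)

adjacentSwap-lowers : ∀ p {n} (i : Fin n) → toℕ i ≡ suc p → toℕ (adjacentSwap p i) ≡ p
adjacentSwap-lowers zero    {suc (suc n)} (fsuc fzero) _ = ≡.refl
adjacentSwap-lowers (suc p)               (fsuc i)     e = ≡.cong suc (adjacentSwap-lowers p i (≡.cong ℕ.pred e))

adjacentSwap-injective : ∀ p {n} {i j : Fin n} → adjacentSwap p i ≡ adjacentSwap p j → i ≡ j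
adjacentSwap-injective p {i = i} {j} e =
  ≡.trans (≡.sym (adjacentSwap-involutive p i))
          (≡.trans (≡.cong (adjacentSwap p) e) (adjacentSwap-involutive p j))

∘-adjacentSwap-injective : ∀ p {n m} (f : Fin n → Fin m) →
  IsInjection (f ∘ adjacentSwap p) ⇔ IsInjection f
∘-adjacentSwap-injective p f = mk⇔
  (λ inj i j e → adjacentSwap-injective p
                   (inj _ _ (≡.trans (fτ²≡f i) (≡.trans e (≡.sym (fτ²≡f j))))))
  (λ inj i j e → adjacentSwap-injective p (inj _ _ e))
  where
  fτ²≡f : ∀ i → f (adjacentSwap p (adjacentSwap p i)) ≡ f i
  fτ²≡f i = ≡.cong f (adjacentSwap-involutive p i)

module _ {c ℓ} (A : Setoid c ℓ) where
  open Setoid A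

  AdjacentEqualUpTo : ∀ {n} → (Fin n → Carrier) → ℕ → Set ℓ
  AdjacentEqualUpTo F b = ∀ i j → suc (toℕ i) ≡ toℕ j → toℕ j ≤ b → F i ≈ F j

  private
    tail-adjacentEqual : ∀ {n b} {F : Fin (suc n) → Carrier} →
      AdjacentEqualUpTo F (suc b) → AdjacentEqualUpTo (F ∘ fsuc) b
    tail-adjacentEqual step i j e j≤b = step (fsuc i) (fsuc j) (≡.cong suc e) (s≤s j≤b)

  adjacentEqual⇒equal : ∀ {n} (F : Fin n → Carrier) {b} → AdjacentEqualUpTo F b →
    ∀ i j → toℕ i ≤ toℕ j → toℕ j ≤ b → F i ≈ F j
  adjacentEqual⇒equal F step fzero    fzero           _         _         = refl
  adjacentEqual⇒equal F step fzero    (fsuc fzero)    _         1≤b       = step fzero (fsuc fzero) ≡.refl 1≤b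
  adjacentEqual⇒equal F step fzero    (fsuc (fsuc j)) _         (s≤s j≤b) =
    trans (step fzero (fsuc fzero) ≡.refl (s≤s z≤n))
          (adjacentEqual⇒equal (F ∘ fsuc) (tail-adjacentEqual step) fzero (fsuc j) z≤n j≤b)
  adjacentEqual⇒equal F step (fsuc i) (fsuc j)        (s≤s i≤j) (s≤s j≤b) =
    adjacentEqual⇒equal (F ∘ fsuc) (tail-adjacentEqual step) i j i≤j j≤b

module Summation {c ℓ} (𝕊 : CommutativeSemiring c ℓ) where
  open CommutativeSemiring 𝕊
  open import Algebra.Properties.CommutativeSemigroup +-commutativeSemigroup using (interchange)
  open import Algebra.Properties.Semiring.Mult semiring public using () renaming (_×_ to _·_)
  open import Algebra.Properties.Semiring.Mult semiring using (×-congʳ; ×-assoc-*)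
  open import Relation.Binary.Reasoning.Setoid setoid

  -- Definitionally RingOps.sumList when 𝕊 comes from a ring; over ℕ it counts.
  sumList : ∀ {a} {A : Set a} → (A → Carrier) → List A → Carrier
  sumList f = foldr (λ a acc → f a + acc) 0#

  private variable
    a b : Level
    A : Set a
    B : Set b

  sumList-cong-∈ : ∀ {f g : A → Carrier} xs → (∀ {a} → a ∈ xs → f a ≈ g a) →
    sumList f xs ≈ sumList g xs
  sumList-cong-∈ []       f≈g = refl
  sumList-cong-∈ (a ∷ xs) f≈g = +-cong (f≈g (here ≡.refl)) (sumList-cong-∈ xs (f≈g ∘ there))

  sumList-cong : ∀ {f g : A → Carrier} xs → (∀ a → f a ≈ g a) → sumList f xs ≈ sumList g xs
  sumList-cong xs f≈g = sumList-cong-∈ xs (λ {a} _ → f≈g a)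

  sumList-zero : ∀ (xs : List A) → sumList (λ _ → 0#) xs ≈ 0#
  sumList-zero []       = refl
  sumList-zero (a ∷ xs) = trans (+-identityˡ _) (sumList-zero xs)

  sumList-distrib-+ : ∀ (f g : A → Carrier) xs →
    sumList (λ a → f a + g a) xs ≈ sumList f xs + sumList g xs
  sumList-distrib-+ f g []       = sym (+-identityˡ 0#)
  sumList-distrib-+ f g (a ∷ xs) =
    trans (+-congˡ (sumList-distrib-+ f g xs)) (interchange (f a) (g a) _ _)

  sumList-*ˡ : ∀ z (f : A → Carrier) xs → sumList (λ a → z * f a) xs ≈ z * sumList f xs
  sumList-*ˡ z f []       = sym (zeroʳ z)
  sumList-*ˡ z f (a ∷ xs) = trans (+-congˡ (sumList-*ˡ z f xs)) (sym (distribˡ z _ _))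

  sumList-*ʳ : ∀ z (f : A → Carrier) xs → sumList (λ a → f a * z) xs ≈ sumList f xs * z
  sumList-*ʳ z f []       = sym (zeroˡ z)
  sumList-*ʳ z f (a ∷ xs) = trans (+-congˡ (sumList-*ʳ z f xs)) (sym (distribʳ z _ _))

  sumList-· : ∀ k (f : A → Carrier) xs → sumList (λ a → k · f a) xs ≈ k · sumList f xs
  sumList-· k f xs = begin
    sumList (λ a → k · f a) xs        ≈⟨ sumList-cong xs (λ a → ·≈·1* (f a)) ⟩
    sumList (λ a → (k · 1#) * f a) xs ≈⟨ sumList-*ˡ (k · 1#) f xs ⟩
    (k · 1#) * sumList f xs           ≈⟨ ·≈·1* _ ⟨
    k · sumList f xs                  ∎
    where
    ·≈·1* : ∀ y → k · y ≈ (k · 1#) * y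
    ·≈·1* y = sym (trans (×-assoc-* k 1# y) (×-congʳ k (*-identityˡ y)))

  sumList-const : ∀ z (xs : List A) → sumList (λ _ → z) xs ≈ length xs · z
  sumList-const z []       = refl
  sumList-const z (a ∷ xs) = +-congˡ (sumList-const z xs)

  sumList-if : ∀ b (f : A → Carrier) xs →
    sumList (λ a → if b then f a else 0#) xs ≈ (if b then sumList f xs else 0#)
  sumList-if true  f xs = refl
  sumList-if false f xs = sumList-zero xs

  sumList-++ : ∀ (f : A → Carrier) xs ys → sumList f (xs ++ ys) ≈ sumList f xs + sumList f ys
  sumList-++ f []       ys = sym (+-identityˡ _)
  sumList-++ f (a ∷ xs) ys = trans (+-congˡ (sumList-++ f xs ys)) (sym (+-assoc _ _ _))

  sumList-filter : ∀ {p} {P : A → Set p} (P? : ∀ a → Dec (P a)) (f : A → Carrier) xs →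
    sumList f (filter P? xs) ≈ sumList (λ a → if does (P? a) then f a else 0#) xs
  sumList-filter P? f []       = refl
  sumList-filter P? f (a ∷ xs) with does (P? a)
  ... | true  = +-congˡ (sumList-filter P? f xs)
  ... | false = trans (sumList-filter P? f xs) (sym (+-identityˡ _))

  sumList-map : ∀ (f : B → Carrier) (g : A → B) xs → sumList f (map g xs) ≈ sumList (f ∘ g) xs
  sumList-map f g []       = refl
  sumList-map f g (a ∷ xs) = +-congˡ (sumList-map f g xs)

  sumList-concatMap : ∀ (f : B → Carrier) (g : A → List B) xs →
    sumList f (concatMap g xs) ≈ sumList (λ a → sumList f (g a)) xs
  sumList-concatMap f g []       = refl
  sumList-concatMap f g (a ∷ xs) =
    trans (sumList-++ f (g a) (concatMap g xs)) (+-congˡ (sumList-concatMap f g xs))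

  sumList-comm : ∀ (f : A → B → Carrier) xs ys →
    sumList (λ a → sumList (f a) ys) xs ≈ sumList (λ b → sumList (λ a → f a b) xs) ys
  sumList-comm f []       ys = sym (sumList-zero ys)
  sumList-comm f (a ∷ xs) ys = begin
    sumList (f a) ys + sumList (λ a → sumList (f a) ys) xs          ≈⟨ +-congˡ (sumList-comm f xs ys) ⟩
    sumList (f a) ys + sumList (λ b → sumList (λ a → f a b) xs) ys  ≈⟨ sumList-distrib-+ _ _ ys ⟨
    sumList (λ b → f a b + sumList (λ a → f a b) xs) ys             ∎

  if-not-+-if : ∀ b y → (if not b then y else 0#) + (if b then y else 0#) ≈ y
  if-not-+-if true  y = +-identityˡ y
  if-not-+-if false y = +-identityʳ y

  if-dec-congʳ : ∀ {p} {P : Set p} (d : Dec P) {y y′ z} → (P → y ≈ y′) →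
    (if does d then y else z) ≈ (if does d then y′ else z)
  if-dec-congʳ (yes p) y≈y′ = y≈y′ p
  if-dec-congʳ (no _)  _    = refl

  if-*ʳ : ∀ b y z → (if b then y else 0#) * z ≈ (if b then y * z else 0#)
  if-*ʳ true  y z = refl
  if-*ʳ false y z = zeroˡ z

  sumList-allFin-suc : ∀ {m} (f : Fin (suc m) → Carrier) →
    sumList f (allFin (suc m)) ≈ f fzero + sumList (f ∘ fsuc) (allFin m)
  sumList-allFin-suc {m} f = +-congˡ (sumList-map f fsuc (allFin m))

  sumList-allFin-δ : ∀ {m} (b : Fin m) (x : Fin m → Carrier) →
    sumList (λ a → if does (b ≟ a) then x a else 0#) (allFin m) ≈ x b
  sumList-allFin-δ {suc m} fzero    x =
    trans (sumList-allFin-suc (λ a → if does (fzero ≟ a) then x a else 0#))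
          (trans (+-congˡ (sumList-zero (allFin m))) (+-identityʳ (x fzero)))
  sumList-allFin-δ {suc m} (fsuc b) x =
    trans (sumList-allFin-suc (λ a → if does (fsuc b ≟ a) then x a else 0#))
          (trans (+-identityˡ _) (sumList-allFin-δ b (x ∘ fsuc)))

  -- The indicator is the complement of the one in factor, and in this form it reduces under suc.
  sumList-allFin-≤ : ∀ {n} h → h < n → ∀ z →
    sumList (λ a → if not (does (h ℕ.<? toℕ a)) then z else 0#) (allFin n) ≈ suc h · z
  sumList-allFin-≤ {suc n} zero    _         z =
    +-congˡ (trans (sumList-map _ fsuc (allFin n)) (sumList-zero (allFin n)))
  sumList-allFin-≤ {suc n} (suc h) (s≤s h<n) z =
    +-congˡ (trans (sumList-map _ fsuc (allFin n)) (sumList-allFin-≤ h h<n z))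

  sumList-∘-injection : ∀ {p m} (f : Fin p → Fin m) → IsInjection f → ∀ x →
    sumList (x ∘ f) (allFin p) ≈ sumList (λ a → if does (inImage? f a) then x a else 0#) (allFin m)
  sumList-∘-injection {zero}  {m} f _   x = sym (sumList-zero (allFin m))
  sumList-∘-injection {suc p} {m} f inj x = begin
    sumList (x ∘ f) (allFin (suc p))
      ≈⟨ sumList-allFin-suc (x ∘ f) ⟩
    x (f fzero) + sumList (x ∘ f ∘ fsuc) (allFin p)
      ≈⟨ +-cong (sym (sumList-allFin-δ (f fzero) x)) (sumList-∘-injection (f ∘ fsuc) tail-injective x) ⟩
    sumList (λ a → if does (f fzero ≟ a) then x a else 0#) (allFin m) +
    sumList (λ a → if does (inImage? (f ∘ fsuc) a) then x a else 0#) (allFin m)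
      ≈⟨ sumList-distrib-+ _ _ (allFin m) ⟨
    sumList (λ a → (if does (f fzero ≟ a) then x a else 0#) +
                   (if does (inImage? (f ∘ fsuc) a) then x a else 0#)) (allFin m)
      ≈⟨ sumList-cong (allFin m) head-+-tail ⟩
    sumList (λ a → if does (inImage? f a) then x a else 0#) (allFin m) ∎
    where
    open Equivalence (isInjection-uncons f) using (to)
    tail-injective = proj₁ (to inj)
    head-fresh = proj₂ (to inj)
    head-+-tail : ∀ a →
      (if does (f fzero ≟ a) then x a else 0#) + (if does (inImage? (f ∘ fsuc) a) then x a else 0#) ≈
      (if does (f fzero ≟ a) ∨ does (inImage? (f ∘ fsuc) a) then x a else 0#)
    head-+-tail a with f fzero ≟ a
    ... | yes ≡.refl rewrite dec-false (inImage? (f ∘ fsuc) (f fzero)) head-fresh = +-identityʳ _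
    ... | no  _      = +-identityˡ _

  sumList-∘-permutation : ∀ {n} (σ : Fin n → Fin n) → IsInjection σ → ∀ x →
    sumList (x ∘ σ) (allFin n) ≈ sumList x (allFin n)
  sumList-∘-permutation {n} σ inj x = trans (sumList-∘-injection σ inj x) (sumList-cong (allFin n) hit)
    where
    hit : ∀ a → (if does (inImage? σ a) then x a else 0#) ≈ x a
    hit a = reflexive (≡.cong (if_then x a else 0#) (dec-true (inImage? σ a) (injective⇒surjective σ inj a)))

  sumList-allFuns-suc : ∀ {n m} (g : (Fin (suc n) → Fin m) → Carrier) →
    sumList g (allFuns (suc n) m) ≈
    sumList (λ f → sumList (λ a → g (cons a f)) (allFin m)) (allFuns n m)
  sumList-allFuns-suc {n} {m} g = trans (sumList-concatMap g _ (allFuns n m))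
    (sumList-cong (allFuns n m) (λ f → sumList-map g (λ a → cons a f) (allFin m)))

  sumList-allFuns-∘adjacentSwap : ∀ p {n m} (g : (Fin n → Fin m) → Carrier) →
    g Preserves _≗_ ⟶ _≈_ →
    sumList (λ f → g (f ∘ adjacentSwap p)) (allFuns n m) ≈ sumList g (allFuns n m)
  sumList-allFuns-∘adjacentSwap p       {zero}        g g-resp = +-congʳ (g-resp (λ ()))
  sumList-allFuns-∘adjacentSwap zero    {suc zero} {m} g g-resp =
    sumList-cong (allFuns 1 m) (λ f → g-resp (λ { fzero → ≡.refl }))
  sumList-allFuns-∘adjacentSwap zero    {suc (suc n)} {m} g g-resp = begin
    sumList (λ f → g (f ∘ adjacentSwap 0)) (allFuns (suc (suc n)) m)
      ≈⟨ sumList-allFuns-suc (λ f → g (f ∘ adjacentSwap 0)) ⟩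
    sumList (λ f → sumList (λ a → g (cons a f ∘ adjacentSwap 0)) (allFin m)) (allFuns (suc n) m)
      ≈⟨ sumList-allFuns-suc (λ f → sumList (λ a → g (cons a f ∘ adjacentSwap 0)) (allFin m)) ⟩
    sumList (λ h → sumList (λ b → sumList (λ a → g (cons a (cons b h) ∘ adjacentSwap 0))
      (allFin m)) (allFin m)) (allFuns n m)
      ≈⟨ sumList-cong (allFuns n m) (λ h → sumList-cong (allFin m) (λ b → sumList-cong (allFin m) (λ a →
           g-resp (λ { fzero → ≡.refl ; (fsuc fzero) → ≡.refl ; (fsuc (fsuc i)) → ≡.refl })))) ⟩
    sumList (λ h → sumList (λ b → sumList (λ a → g (cons b (cons a h))) (allFin m)) (allFin m)) (allFuns n m)
      ≈⟨ sumList-cong (allFuns n m) (λ h →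
           sumList-comm (λ b a → g (cons b (cons a h))) (allFin m) (allFin m)) ⟩
    sumList (λ h → sumList (λ a → sumList (λ b → g (cons b (cons a h))) (allFin m)) (allFin m)) (allFuns n m)
      ≈⟨ sumList-allFuns-suc (λ f → sumList (λ b → g (cons b f)) (allFin m)) ⟨
    sumList (λ f → sumList (λ b → g (cons b f)) (allFin m)) (allFuns (suc n) m)
      ≈⟨ sumList-allFuns-suc g ⟨
    sumList g (allFuns (suc (suc n)) m) ∎
  sumList-allFuns-∘adjacentSwap (suc p) {suc n} {m} g g-resp = begin
    sumList (λ f → g (f ∘ adjacentSwap (suc p))) (allFuns (suc n) m)
      ≈⟨ sumList-allFuns-suc (λ f → g (f ∘ adjacentSwap (suc p))) ⟩
    sumList (λ f → sumList (λ a → g (cons a f ∘ adjacentSwap (suc p))) (allFin m)) (allFuns n m)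
      ≈⟨ sumList-cong (allFuns n m) (λ f → sumList-cong (allFin m) (λ a →
           g-resp (λ { fzero → ≡.refl ; (fsuc i) → ≡.refl }))) ⟩
    sumList (λ f → extend (f ∘ adjacentSwap p)) (allFuns n m)
      ≈⟨ sumList-allFuns-∘adjacentSwap p extend extend-resp ⟩
    sumList extend (allFuns n m)
      ≈⟨ sumList-allFuns-suc g ⟨
    sumList g (allFuns (suc n) m) ∎
    where
    extend : (Fin n → Fin m) → Carrier
    extend f = sumList (λ a → g (cons a f)) (allFin m)
    extend-resp : extend Preserves _≗_ ⟶ _≈_
    extend-resp f≗f′ = sumList-cong (allFin m) (λ a → g-resp (cons-cong a f≗f′))

  sumList-Sym-∘adjacentSwap : ∀ p {n} (g : (Fin n → Fin n) → Carrier) → g Preserves _≗_ ⟶ _≈_ →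
    sumList (λ σ → g (σ ∘ adjacentSwap p)) (Sym n) ≈ sumList g (Sym n)
  sumList-Sym-∘adjacentSwap p {n} g g-resp = begin
    sumList (λ σ → g (σ ∘ adjacentSwap p)) (Sym n)
      ≈⟨ sumList-filter injective? _ (allFuns n n) ⟩
    sumList (λ σ → if does (injective? σ) then g (σ ∘ adjacentSwap p) else 0#) (allFuns n n)
      ≈⟨ sumList-cong (allFuns n n) (λ σ → reflexive (≡.cong (if_then g (σ ∘ adjacentSwap p) else 0#)
           (≡.sym (does-⇔ (∘-adjacentSwap-injective p σ)
                          (injective? (σ ∘ adjacentSwap p)) (injective? σ))))) ⟩
    sumList (λ σ → onSym (σ ∘ adjacentSwap p)) (allFuns n n)
      ≈⟨ sumList-allFuns-∘adjacentSwap p onSym onSym-resp ⟩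
    sumList onSym (allFuns n n)
      ≈⟨ sumList-filter injective? g (allFuns n n) ⟨
    sumList g (Sym n) ∎
    where
    onSym : (Fin n → Fin n) → Carrier
    onSym σ = if does (injective? σ) then g σ else 0#
    onSym-resp : onSym Preserves _≗_ ⟶ _≈_
    onSym-resp {σ} {σ′} σ≗σ′
      rewrite does-⇔ (mk⇔ (isInjection-resp σ≗σ′) (isInjection-resp (≡.sym ∘ σ≗σ′)))
                     (injective? σ) (injective? σ′)
      = if-dec-congʳ (injective? σ′) (λ _ → g-resp σ≗σ′)

  DependsOnlyAbove : ∀ {n} → ℕ → ((Fin n → Fin n) → Carrier) → Set ℓ
  DependsOnlyAbove b g = ∀ {σ σ′} → (∀ j → b < toℕ j → σ j ≡ σ′ j) → g σ ≈ g σ′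

  sumList-Sym-symmetric : ∀ {n} b (g : (Fin n → Fin n) → Carrier) → DependsOnlyAbove b g →
    ∀ (y : Fin n → Carrier) i j → toℕ i ≤ toℕ j → toℕ j ≤ b →
    sumList (λ σ → y (σ i) * g σ) (Sym n) ≈ sumList (λ σ → y (σ j) * g σ) (Sym n)
  sumList-Sym-symmetric {n} b g g-local y = adjacentEqual⇒equal setoid weighted adjacent
    where
    weighted : Fin n → Carrier
    weighted i = sumList (λ σ → y (σ i) * g σ) (Sym n)
    adjacent : AdjacentEqualUpTo setoid weighted b
    adjacent i j i+1≡j j≤b = begin
      weighted i                                         ≈⟨ sumList-cong (Sym n) swap-back ⟩
      sumList (λ σ → y ((σ ∘ τ) j) * g (σ ∘ τ)) (Sym n)  ≈⟨ sumList-Sym-∘adjacentSwap (toℕ i) _ resp ⟩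
      weighted j                                         ∎
      where
      τ = adjacentSwap (toℕ i)
      τj≡i : τ j ≡ i
      τj≡i = toℕ-injective (adjacentSwap-lowers (toℕ i) j (≡.sym i+1≡j))
      swap-back : ∀ σ → y (σ i) * g σ ≈ y (σ (τ j)) * g (σ ∘ τ)
      swap-back σ = *-cong (reflexive (≡.cong (y ∘ σ) (≡.sym τj≡i)))
        (g-local (λ k b<k → ≡.sym (≡.cong σ (adjacentSwap-fixes (toℕ i) k
          (ℕₚ.≤-trans (s≤s (ℕₚ.≤-reflexive i+1≡j)) (ℕₚ.≤-trans (s≤s j≤b) b<k))))))
      resp : (λ σ → y (σ j) * g σ) Preserves _≗_ ⟶ _≈_
      resp σ≗σ′ = *-cong (reflexive (≡.cong y (σ≗σ′ j))) (g-local (λ k _ → σ≗σ′ k))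

private module ℕΣ = Summation ℕₚ.+-*-commutativeSemiring

injectionCount : ℕ → ℕ → ℕ
injectionCount p m = ℕΣ.sumList (λ f → if does (isInjection? f) then 1 else 0) (allFuns p m)

length-allFin : ∀ m → length (allFin m) ≡ m
length-allFin zero    = ≡.refl
length-allFin (suc m) = ≡.cong suc (≡.trans (length-map fsuc (allFin m)) (length-allFin m))

freshCount : ∀ {p m} (f : Fin p → Fin m) → IsInjection f →
  ℕΣ.sumList (λ a → if not (does (inImage? f a)) then 1 else 0) (allFin m) ≡ m ℕ.∸ p
freshCount {p} {m} f inj = begin
  fresh               ≡⟨ ℕₚ.m+n∸n≡m fresh p ⟨
  fresh ℕ.+ p ℕ.∸ p   ≡⟨ ≡.cong (ℕ._∸ p) fresh+p≡m ⟩
  m ℕ.∸ p             ∎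
  where
  open ≡.≡-Reasoning
  fresh = ℕΣ.sumList (λ a → if not (does (inImage? f a)) then 1 else 0) (allFin m)
  hit   = ℕΣ.sumList (λ a → if does (inImage? f a) then 1 else 0) (allFin m)
  fresh+p≡m : fresh ℕ.+ p ≡ m
  fresh+p≡m = begin
    fresh ℕ.+ p     ≡⟨ ≡.cong (fresh ℕ.+_) (≡.sym (length-allFin p)) ⟩
    fresh ℕ.+ length (allFin p)
                    ≡⟨ ≡.cong (fresh ℕ.+_) (ℕΣ.sumList-∘-injection f inj (λ _ → 1)) ⟩
    fresh ℕ.+ hit   ≡⟨ ℕΣ.sumList-distrib-+ _ _ (allFin m) ⟨
    ℕΣ.sumList (λ a → (if not (does (inImage? f a)) then 1 else 0) ℕ.+
                      (if does (inImage? f a) then 1 else 0)) (allFin m)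
                    ≡⟨ ℕΣ.sumList-cong (allFin m) (λ a → ℕΣ.if-not-+-if (does (inImage? f a)) 1) ⟩
    length (allFin m) ≡⟨ length-allFin m ⟩
    m               ∎

extensionCount : ∀ {p m} (f : Fin p → Fin m) →
  ℕΣ.sumList (λ a → if does (isInjection? (cons a f)) then 1 else 0) (allFin m) ≡
  (m ℕ.∸ p) ℕ.* (if does (isInjection? f) then 1 else 0)
extensionCount {p} {m} f = ≡.trans
  (ℕΣ.sumList-cong (allFin m) (λ a → ≡.cong (if_then 1 else 0)
    (does-⇔ (isInjection-uncons (cons a f))
            (isInjection? (cons a f)) (isInjection? f ×-dec ¬? (inImage? f a)))))
  (byCases (isInjection? f))
  where
  byCases : (inj? : Dec (IsInjection f)) →
    ℕΣ.sumList (λ a → if does inj? ∧ not (does (inImage? f a)) then 1 else 0) (allFin m) ≡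
    (m ℕ.∸ p) ℕ.* (if does inj? then 1 else 0)
  byCases (yes inj) = ≡.trans (freshCount f inj) (≡.sym (ℕₚ.*-identityʳ _))
  byCases (no _)    = ≡.trans (ℕΣ.sumList-zero (allFin m)) (≡.sym (ℕₚ.*-zeroʳ (m ℕ.∸ p)))

injectionCount≡P′ : ∀ p m → injectionCount p m ≡ m P′ p
injectionCount≡P′ zero    m = ≡.refl
injectionCount≡P′ (suc p) m = begin
  injectionCount (suc p) m
    ≡⟨ ℕΣ.sumList-allFuns-suc {p} {m} (λ f → if does (isInjection? f) then 1 else 0) ⟩
  ℕΣ.sumList (λ f → ℕΣ.sumList (λ a → if does (isInjection? (cons a f)) then 1 else 0) (allFin m))
             (allFuns p m)
    ≡⟨ ℕΣ.sumList-cong (allFuns p m) extensionCount ⟩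
  ℕΣ.sumList (λ f → (m ℕ.∸ p) ℕ.* (if does (isInjection? f) then 1 else 0)) (allFuns p m)
    ≡⟨ ℕΣ.sumList-*ˡ (m ℕ.∸ p) _ (allFuns p m) ⟩
  (m ℕ.∸ p) ℕ.* injectionCount p m
    ≡⟨ ≡.cong ((m ℕ.∸ p) ℕ.*_) (injectionCount≡P′ p m) ⟩
  m P′ suc p ∎
  where open ≡.≡-Reasoning

length-Sym : ∀ n → length (Sym n) ≡ n !
length-Sym n = begin
  length (Sym n)                         ≡⟨⟩
  ℕΣ.sumList (λ _ → 1) (Sym n)           ≡⟨ ℕΣ.sumList-filter injective? (λ _ → 1) (allFuns n n) ⟩
  injectionCount n n                     ≡⟨ injectionCount≡P′ n n ⟩
  n P′ n                                 ≡⟨ ≡.cong (if_then n P′ n else 0) n≤ᵇn ⟨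
  (if n ℕ.≤ᵇ n then n P′ n else 0)       ≡⟨⟩
  n P n                                  ≡⟨ nPn≡n! n ⟩
  n !                                    ∎
  where
  open ≡.≡-Reasoning
  n≤ᵇn : (n ℕ.≤ᵇ n) ≡ true
  n≤ᵇn = Equivalence.to T-≡ (ℕₚ.≤⇒≤ᵇ (ℕₚ.≤-refl {n}))

module _ {c ℓ} (R : CommutativeRing c ℓ) where
  open CommutativeRing R
  open RingOps R using (sumFin; prodFin; factor; term; _^_)
  open Summation commutativeSemiring
  open import Algebra.Properties.Semiring.Mult semiring using (×-assoc-*; ×-comm-*)
  open import Relation.Binary.Reasoning.Setoid setoid

  ringOps-·≡· : ∀ k r → RingOps._·_ R k r ≡ k · r
  ringOps-·≡· zero    r = ≡.refl
  ringOps-·≡· (suc k) r = ≡.cong (r +_) (ringOps-·≡· k r)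

  sumFin≈sumList : ∀ n (f : Fin n → Carrier) → sumFin n f ≈ sumList f (allFin n)
  sumFin≈sumList zero    f = refl
  sumFin≈sumList (suc n) f =
    +-congˡ (trans (sumFin≈sumList n (f ∘ fsuc)) (sym (sumList-map f fsuc (allFin n))))

  sumFin-cong : ∀ n {f g : Fin n → Carrier} → (∀ i → f i ≈ g i) → sumFin n f ≈ sumFin n g
  sumFin-cong zero    f≈g = refl
  sumFin-cong (suc n) f≈g = +-cong (f≈g fzero) (sumFin-cong n (f≈g ∘ fsuc))

  prodFin-cong : ∀ n {f g : Fin n → Carrier} → (∀ i → f i ≈ g i) → prodFin n f ≈ prodFin n g
  prodFin-cong zero    f≈g = refl
  prodFin-cong (suc n) f≈g = *-cong (f≈g fzero) (prodFin-cong n (f≈g ∘ fsuc))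

  -- term n (suc h) x σ is by definition prodFrom n h (factor n x σ).
  prodFrom : ∀ n → ℕ → (Fin n → Carrier) → Carrier
  prodFrom n h F = prodFin n (λ i → if does (suc h ℕ.≤? suc (toℕ i)) then F i else 1#)

  prodFrom-suc : ∀ {n} h (F : Fin (suc n) → Carrier) → prodFrom (suc n) (suc h) F ≈ prodFrom n h (F ∘ fsuc)
  prodFrom-suc h F = *-identityˡ _

  prodFrom-split : ∀ {n} (i : Fin n) F → prodFrom n (toℕ i) F ≈ F i * prodFrom n (suc (toℕ i)) F
  prodFrom-split {suc n} fzero    F = *-congˡ (sym (prodFrom-suc 0 F))
  prodFrom-split {suc n} (fsuc i) F = begin
    prodFrom (suc n) (suc (toℕ i)) F                     ≈⟨ prodFrom-suc (toℕ i) F ⟩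
    prodFrom n (toℕ i) (F ∘ fsuc)                        ≈⟨ prodFrom-split i (F ∘ fsuc) ⟩
    F (fsuc i) * prodFrom n (suc (toℕ i)) (F ∘ fsuc)     ≈⟨ *-congˡ (prodFrom-suc (suc (toℕ i)) F) ⟨
    F (fsuc i) * prodFrom (suc n) (suc (suc (toℕ i))) F  ∎

  prodFrom-beyond : ∀ {n} h F → n ≤ h → prodFrom n h F ≈ 1#
  prodFrom-beyond {zero}  h       F _         = refl
  prodFrom-beyond {suc n} (suc h) F (s≤s n≤h) = trans (prodFrom-suc h F) (prodFrom-beyond h (F ∘ fsuc) n≤h)

  prodFrom-local : ∀ {n} h {F G : Fin n → Carrier} → (∀ i → h ≤ toℕ i → F i ≈ G i) →
    prodFrom n h F ≈ prodFrom n h G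
  prodFrom-local {n} h F≈G = prodFin-cong n (λ i →
    if-dec-congʳ (suc h ℕ.≤? suc (toℕ i)) (λ { (s≤s h≤i) → F≈G i h≤i }))

  factor-local : ∀ {n} x (σ σ′ : Fin n → Fin n) i → (∀ j → toℕ i ≤ toℕ j → σ j ≡ σ′ j) →
    factor n x σ i ≈ factor n x σ′ i
  factor-local {n} x σ σ′ i agree =
    +-cong (reflexive (≡.cong (RingOps._·_ R (suc (toℕ i)) ∘ x) (agree i ℕₚ.≤-refl)))
           (sumFin-cong n (λ m → if-dec-congʳ (toℕ i ℕ.<? toℕ m) (λ i<m →
             reflexive (≡.cong x (agree m (ℕₚ.<⇒≤ i<m))))))

  term-local : ∀ {n} x h → DependsOnlyAbove h (term n (suc (suc h)) x)
  term-local x h agree = prodFrom-local (suc h) (λ i h<i →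
    factor-local x _ _ i (λ j i≤j → agree j (ℕₚ.≤-trans h<i i≤j)))

  module _ {n} (x : Fin n → Carrier) where

    sumList-Sym-term-step : ∀ (i : Fin n) →
      sumList (term n (suc (toℕ i)) x) (Sym n) ≈
      sumFin n x * sumList (term n (suc (suc (toℕ i))) x) (Sym n)
    sumList-Sym-term-step i = begin
      sumList (term n (suc h) x) (Sym n)
        ≈⟨ sumList-cong (Sym n) (λ σ → prodFrom-split i (factor n x σ)) ⟩
      sumList (λ σ → factor n x σ i * rest σ) (Sym n)
        ≈⟨ sumList-cong (Sym n) factor-*-rest ⟩
      sumList (λ σ → suc h · weighted σ i + sumList (λ m → above m (weighted σ m)) (allFin n)) (Sym n)
        ≈⟨ sumList-distrib-+ _ _ (Sym n) ⟩
      sumList (λ σ → suc h · weighted σ i) (Sym n) +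
      sumList (λ σ → sumList (λ m → above m (weighted σ m)) (allFin n)) (Sym n)
        ≈⟨ +-cong (sumList-· (suc h) _ (Sym n)) (sumList-comm _ (Sym n) (allFin n)) ⟩
      suc h · E i + sumList (λ m → sumList (λ σ → above m (weighted σ m)) (Sym n)) (allFin n)
        ≈⟨ +-cong (sym notAbove-E)
                  (sumList-cong (allFin n) (λ m → sumList-if (does (h ℕ.<? toℕ m)) _ (Sym n))) ⟩
      sumList (λ m → notAbove m (E m)) (allFin n) + sumList (λ m → above m (E m)) (allFin n)
        ≈⟨ sumList-distrib-+ _ _ (allFin n) ⟨
      sumList (λ m → notAbove m (E m) + above m (E m)) (allFin n)
        ≈⟨ sumList-cong (allFin n) (λ m → if-not-+-if (does (h ℕ.<? toℕ m)) (E m)) ⟩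
      sumList E (allFin n)
        ≈⟨ sumList-comm weighted (Sym n) (allFin n) ⟨
      sumList (λ σ → sumList (weighted σ) (allFin n)) (Sym n)
        ≈⟨ sumList-cong-∈ (Sym n) (λ σ∈Sym →
             total (proj₂ (∈-filter⁻ injective? {xs = allFuns n n} σ∈Sym))) ⟩
      sumList (λ σ → sumFin n x * rest σ) (Sym n)
        ≈⟨ sumList-*ˡ (sumFin n x) rest (Sym n) ⟩
      sumFin n x * sumList rest (Sym n) ∎
      where
      h = toℕ i
      rest = term n (suc (suc h)) x
      weighted : (Fin n → Fin n) → Fin n → Carrier
      weighted σ m = x (σ m) * rest σ
      E : Fin n → Carrier
      E m = sumList (λ σ → weighted σ m) (Sym n)
      above notAbove : Fin n → Carrier → Carrier
      above    m y = if does (h ℕ.<? toℕ m) then y else 0#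
      notAbove m y = if not (does (h ℕ.<? toℕ m)) then y else 0#

      factor-*-rest : ∀ σ → factor n x σ i * rest σ ≈
        suc h · weighted σ i + sumList (λ m → above m (weighted σ m)) (allFin n)
      factor-*-rest σ = trans (distribʳ (rest σ) _ _) (+-cong
        (trans (reflexive (≡.cong (_* rest σ) (ringOps-·≡· (suc h) (x (σ i))))) (×-assoc-* (suc h) _ _))
        (begin
          sumFin n (λ m → above m (x (σ m))) * rest σ               ≈⟨ *-congʳ (sumFin≈sumList n _) ⟩
          sumList (λ m → above m (x (σ m))) (allFin n) * rest σ     ≈⟨ sumList-*ʳ (rest σ) _ (allFin n) ⟨
          sumList (λ m → above m (x (σ m)) * rest σ) (allFin n)     ≈⟨ sumList-cong (allFin n) (λ m →
                                                                        if-*ʳ (does (h ℕ.<? toℕ m)) _ _) ⟩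
          sumList (λ m → above m (weighted σ m)) (allFin n)         ∎))

      notAbove-E : sumList (λ m → notAbove m (E m)) (allFin n) ≈ suc h · E i
      notAbove-E = trans
        (sumList-cong (allFin n) (λ m → if-dec-congʳ (¬? (h ℕ.<? toℕ m)) (λ m≯h →
          sumList-Sym-symmetric h rest (term-local x h) x m i (ℕₚ.≮⇒≥ m≯h) ℕₚ.≤-refl)))
        (sumList-allFin-≤ h (toℕ<n i) (E i))

      total : ∀ {σ} → IsInjection σ → sumList (weighted σ) (allFin n) ≈ sumFin n x * rest σ
      total {σ} inj = begin
        sumList (weighted σ) (allFin n)      ≈⟨ sumList-*ʳ (rest σ) (x ∘ σ) (allFin n) ⟩
        sumList (x ∘ σ) (allFin n) * rest σ  ≈⟨ *-congʳ (sumList-∘-permutation σ inj x) ⟩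
        sumList x (allFin n) * rest σ        ≈⟨ *-congʳ (sumFin≈sumList n x) ⟨
        sumFin n x * rest σ                  ∎

    sumList-Sym-term : ∀ d h → d ℕ.+ h ≡ n → sumList (term n (suc h) x) (Sym n) ≈ (n !) · (sumFin n x ^ d)
    sumList-Sym-term zero    h h≡n = begin
      sumList (term n (suc h) x) (Sym n)
        ≈⟨ sumList-cong (Sym n) (λ σ →
             prodFrom-beyond h (factor n x σ) (ℕₚ.≤-reflexive (≡.sym h≡n))) ⟩
      sumList (λ _ → 1#) (Sym n)      ≈⟨ sumList-const 1# (Sym n) ⟩
      length (Sym n) · 1#             ≡⟨ ≡.cong (_· 1#) (length-Sym n) ⟩
      (n !) · 1#                      ∎
    sumList-Sym-term (suc d) h d+h≡n = begin
      sumList (term n (suc h) x) (Sym n)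
        ≡⟨ ≡.cong (λ k → sumList (term n (suc k) x) (Sym n)) (toℕ-fromℕ< h<n) ⟨
      sumList (term n (suc (toℕ i)) x) (Sym n)
        ≈⟨ sumList-Sym-term-step i ⟩
      sumFin n x * sumList (term n (suc (suc (toℕ i))) x) (Sym n)
        ≡⟨ ≡.cong (λ k → sumFin n x * sumList (term n (suc (suc k)) x) (Sym n)) (toℕ-fromℕ< h<n) ⟩
      sumFin n x * sumList (term n (suc (suc h)) x) (Sym n)
        ≈⟨ *-congˡ (sumList-Sym-term d (suc h) (≡.trans (ℕₚ.+-suc d h) d+h≡n)) ⟩
      sumFin n x * ((n !) · (sumFin n x ^ d))
        ≈⟨ ×-comm-* (n !) (sumFin n x) (sumFin n x ^ d) ⟩
      (n !) · (sumFin n x ^ suc d) ∎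
      where
      h<n : h < n
      h<n = ℕₚ.≤-trans (s≤s (ℕₚ.m≤n+m h d)) (ℕₚ.≤-reflexive d+h≡n)
      i : Fin n
      i = fromℕ< h<n

mainTheorem3 : ∀ {c ℓ} (R : CommutativeRing c ℓ) (n k : ℕ) → 1 ≤ k → k ≤ n →
    (x : Fin n → CommutativeRing.Carrier R) →
    CommutativeRing._≈_ R (RingOps.LHS R n k x)
      (RingOps._·_ R (n !) (RingOps._^_ R (RingOps.sumFin R n x) (suc (n ℕ.∸ k))))
mainTheorem3 R n (suc h) _ k≤n x =
  CommutativeRing.trans R (sumList-Sym-term R x (suc (n ℕ.∸ suc h)) h d+h≡n)
                          (CommutativeRing.reflexive R (≡.sym (ringOps-·≡· R (n !) _)))
  where
  d+h≡n : suc (n ℕ.∸ suc h) ℕ.+ h ≡ n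
  d+h≡n = ≡.trans (≡.sym (ℕₚ.+-suc (n ℕ.∸ suc h) h)) (ℕₚ.m∸n+n≡m k≤n)
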